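{- Let $n$ be a positive integer. Then ${8n \choose n}_F$ is odd if and only if $n = \frac{1 + 3 \cdot 2^k}{7}$ for some positive integer $k \equiv 1 \pmod{3}$.
   Context: The Fibonacci sequence is $F_1=F_2=1$, $F_n=F_{n-1}+F_{n-2}$ for $n\ge 3$. For $m\ge 1$ and $1\le k\le m$ the Fibonomial coefficient is ${m \choose k}_F = \frac{F_1F_2\cdots F_m}{(F_1\cdots F_k)(F_1\cdots F_{m-k})}$, which is an integer. -}

module Defs where

open import Data.Nat using (ℕ; zero; suc; _+_; _*_; _∸_; NonZero)
open import Data.Nat.DivMod using (_/_)
open import Data.Nat.Properties using (m*n≢0)

fib : ℕ → ℕ
fib zero = zero
fib (suc zero) = suc zero
fib (suc (suc n)) = fib (suc n) + fib n

fibProd : ℕ → ℕ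
fibProd zero = suc zero
fibProd (suc m) = fib (suc m) * fibProd m

fib-suc-nonZero : ∀ n → NonZero (fib (suc n))
fib-suc-nonZero zero = _
fib-suc-nonZero (suc n) with fib (suc n) | fib-suc-nonZero n
... | suc a | _ = _

fibProd-nonZero : ∀ m → NonZero (fibProd m)
fibProd-nonZero zero = _
fibProd-nonZero (suc m) =
  m*n≢0 (fib (suc m)) (fibProd m) {{fib-suc-nonZero m}} {{fibProd-nonZero m}}

fibonomial : ℕ → ℕ → ℕ
fibonomial m k =
  _/_ (fibProd m) (fibProd k * fibProd (m ∸ k))
    {{m*n≢0 (fibProd k) (fibProd (m ∸ k)) {{fibProd-nonZero k}} {{fibProd-nonZero (m ∸ k)}}}}

-- Write P(m) = F_1⋯F_m and ν₂ for the 2-adic order (Ord₂).  Since (8n choose n)_F · P(n) P(7n)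
-- = P(8n) (the Pascal-type recurrence shows the division is exact), the coefficient is odd
-- iff ν₂ P(8n) = ν₂ P(n) + ν₂ P(7n).  These congruences propagate along residues mod 6 via
--    s_{n+6} = 8 s_{n+1} + 5 s_n, valid for any Fibonacci-like sequence s.
--  * Summing, ν₂ P(3M + r) = prodOrd M := ν₂(M!) + M + ⌊M/2⌋ for r ≤ 2, where ν₂(M!) is given
--    by Legendre's formula (legendre).
--  * prodOrd is superadditive, and strictly so in every situation arising for n ≢ 1 (mod 6).
--    For n = 6u + 1 the balance reduces to ν₂((7u+1)!) = 7u, i.e. 7u + 1 = 2^j, which is the
--    stated condition because 2^j ≡ 1 (mod 7) forces 3 ∣ j.
module Submission where

open import Defs
open import Data.Nat using (ℕ; zero; suc; _+_; _*_; _^_; _≤_; _<_; _%_; _/_; ⌊_/2⌋; ⌈_/2⌉; NonZero; z≤n; s≤s; z<s)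
open import Data.Nat.Properties
open import Data.Nat.DivMod using (m≡m%n+[m/n]*n; [m+kn]%n≡m%n; m*n/n≡m; m<n⇒m%n≡m; m%n<n)
open import Data.Nat.Induction using (<-rec)
open import Data.Nat.Tactic.RingSolver using (solve-∀)
open import Data.Product using (∃; _×_; _,_)
open import Data.Empty using (⊥-elim)
open import Relation.Binary.PropositionalEquality
open import Relation.Nullary using (contradiction)
open import Function.Base using (_∘_)
open import Function.Bundles using (_⇔_; mk⇔)
open import Function.Construct.Composition using (_⇔-∘_)

IsFibLike : (ℕ → ℕ) → Set
IsFibLike s = ∀ n → s (2 + n) ≡ s (1 + n) + s n

fibLike-shift : ∀ s → IsFibLike s → ∀ k n →
  s (suc (k + n)) ≡ fib (suc k) * s (suc n) + fib k * s n
fibLike-shift s rec zero n = one-zero (s (suc n)) (s n)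
  where
    one-zero : ∀ a b → a ≡ 1 * a + 0 * b
    one-zero = solve-∀
fibLike-shift s rec (suc k) n = begin
  s (suc (suc k + n))                                   ≡⟨ cong (λ i → s (suc i)) (sym (+-suc k n)) ⟩
  s (suc (k + suc n))                                   ≡⟨ fibLike-shift s rec k (suc n) ⟩
  fib (suc k) * s (2 + n) + fib k * s (suc n)           ≡⟨ cong (λ x → fib (suc k) * x + fib k * s (suc n)) (rec n) ⟩
  fib (suc k) * (s (suc n) + s n) + fib k * s (suc n)   ≡⟨ regroup (fib (suc k)) (fib k) (s (suc n)) (s n) ⟩
  (fib (suc k) + fib k) * s (suc n) + fib (suc k) * s n ∎
  where
    open ≡-Reasoning
    regroup : ∀ x y a b → x * (a + b) + y * a ≡ (x + y) * a + x * b
    regroup = solve-∀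

lucas : ℕ → ℕ
lucas zero = 2
lucas (suc zero) = 1
lucas (suc (suc n)) = lucas (suc n) + lucas n

lucas-fib : ∀ n → lucas (suc n) ≡ fib (2 + n) + fib n
lucas-fib zero = refl
lucas-fib (suc zero) = refl
lucas-fib (suc (suc n)) = begin
  lucas (2 + n) + lucas (1 + n)                       ≡⟨ cong₂ _+_ (lucas-fib (suc n)) (lucas-fib n) ⟩
  (fib (3 + n) + fib (suc n)) + (fib (2 + n) + fib n) ≡⟨ interchange (fib (3 + n)) (fib (suc n)) (fib (2 + n)) (fib n) ⟩
  (fib (3 + n) + fib (2 + n)) + (fib (suc n) + fib n) ∎
  where
    open ≡-Reasoning
    interchange : ∀ a b c d → (a + b) + (c + d) ≡ (a + c) + (b + d)
    interchange = solve-∀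

fib-double : ∀ n → fib (2 * n) ≡ fib n * lucas n
fib-double zero = refl
fib-double (suc n) = begin
  fib (2 * suc n)                                   ≡⟨ cong fib (index n) ⟩
  fib (suc (suc n + n))                             ≡⟨ fibLike-shift fib (λ _ → refl) (suc n) n ⟩
  fib (2 + n) * fib (suc n) + fib (suc n) * fib n   ≡⟨ factor (fib (2 + n)) (fib (suc n)) (fib n) ⟩
  fib (suc n) * (fib (2 + n) + fib n)               ≡⟨ cong (fib (suc n) *_) (sym (lucas-fib n)) ⟩
  fib (suc n) * lucas (suc n)                       ∎
  where
    open ≡-Reasoning
    index : ∀ n → 2 * suc n ≡ suc (suc n + n)
    index = solve-∀
    factor : ∀ a b c → a * b + b * c ≡ b * (a + c)
    factor = solve-∀

-- The Fibonomial coefficient (a+b choose a)_F, defined by its Pascal-type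
-- recurrence; this exhibits it as a natural number.
fibBinom : ℕ → ℕ → ℕ
fibBinom zero b = 1
fibBinom (suc a) zero = 1
fibBinom (suc a) (suc b) = fib (2 + b) * fibBinom a (suc b) + fib a * fibBinom (suc a) b

fibBinom-spec : ∀ a b → fibBinom a b * (fibProd a * fibProd b) ≡ fibProd (a + b)
fibBinom-spec zero b = trans (*-identityˡ _) (*-identityˡ _)
fibBinom-spec (suc a) zero =
  trans (*-identityˡ _) (trans (*-identityʳ _) (cong fibProd (sym (+-identityʳ (suc a)))))
fibBinom-spec (suc a) (suc b) rewrite +-suc a b = begin
  (F₂ * fibBinom a (suc b) + fib a * fibBinom (suc a) b) * (Fa * fibProd a * (Fb * fibProd b))
    ≡⟨ distribute F₂ Fa (fib a) Fb (fibBinom a (suc b)) (fibBinom (suc a) b) (fibProd a) (fibProd b) ⟩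
  F₂ * Fa * (fibBinom a (suc b) * (fibProd a * fibProd (suc b)))
    + fib a * Fb * (fibBinom (suc a) b * (fibProd (suc a) * fibProd b))
    ≡⟨ cong₂ (λ x y → F₂ * Fa * x + fib a * Fb * y)
         (trans (fibBinom-spec a (suc b)) (cong fibProd (+-suc a b))) (fibBinom-spec (suc a) b) ⟩
  F₂ * Fa * Q + fib a * Fb * Q
    ≡⟨ collect F₂ Fa (fib a) Fb Q ⟩
  (F₂ * Fa + Fb * fib a) * Q
    ≡⟨ cong (_* Q) (sym fib-add) ⟩
  fib (2 + (a + b)) * Q ∎
  where
    open ≡-Reasoning
    F₂ = fib (2 + b)
    Fa = fib (suc a)
    Fb = fib (suc b)
    Q = fibProd (suc (a + b))
    fib-add : fib (2 + (a + b)) ≡ F₂ * Fa + Fb * fib a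
    fib-add = trans (cong (λ i → fib (2 + i)) (+-comm a b)) (fibLike-shift fib (λ _ → refl) (suc b) a)
    distribute : ∀ f₂ fa f fb X Y pa pb → (f₂ * X + f * Y) * (fa * pa * (fb * pb))
      ≡ f₂ * fa * (X * (pa * (fb * pb))) + f * fb * (Y * (fa * pa * pb))
    distribute = solve-∀
    collect : ∀ u v w x q → u * v * q + w * x * q ≡ (u * v + x * w) * q
    collect = solve-∀

fibonomial-exact : ∀ k d → fibonomial (k + d) k * (fibProd k * fibProd d) ≡ fibProd (k + d)
fibonomial-exact k d rewrite m+n∸m≡n k d =
  trans (cong (_* (fibProd k * fibProd d)) quotient≡rec) (fibBinom-spec k d)
  where
    instance
      denominator≢0 : NonZero (fibProd k * fibProd d)
      denominator≢0 = m*n≢0 (fibProd k) (fibProd d) {{fibProd-nonZero k}} {{fibProd-nonZero d}}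
    quotient≡rec : fibProd (k + d) / (fibProd k * fibProd d) ≡ fibBinom k d
    quotient≡rec = trans (cong (_/ (fibProd k * fibProd d)) (sym (fibBinom-spec k d)))
                         (m*n/n≡m (fibBinom k d) (fibProd k * fibProd d))

twice : ∀ m → 2 * m ≡ m + m
twice m = cong (m +_) (+-identityʳ m)

double-suc : ∀ h → suc (suc (2 * h)) ≡ 2 * suc h
double-suc = solve-∀

data Parity : ℕ → Set where
  even : ∀ h → Parity (2 * h)
  odd  : ∀ h → Parity (suc (2 * h))

parity : ∀ n → Parity n
parity zero = even 0
parity (suc n) with parity n
... | even h = odd h
... | odd h = subst Parity (sym (double-suc h)) (even (suc h))

record Ord₂ (x e : ℕ) : Set where
  constructor ord₂
  field
    oddIndex : ℕ
    decomposition : x ≡ 2 ^ e * suc (2 * oddIndex)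

ord₂-* : ∀ {x y e f} → Ord₂ x e → Ord₂ y f → Ord₂ (x * y) (e + f)
ord₂-* {e = e} {f} (ord₂ r refl) (ord₂ s refl) = ord₂ (r + s + 2 * r * s) (begin
  (2 ^ e * suc (2 * r)) * (2 ^ f * suc (2 * s))      ≡⟨ regroup (2 ^ e) (2 ^ f) r s ⟩
  (2 ^ e * 2 ^ f) * suc (2 * (r + s + 2 * r * s))   ≡⟨ cong (_* suc (2 * (r + s + 2 * r * s))) (sym (^-distribˡ-+-* 2 e f)) ⟩
  2 ^ (e + f) * suc (2 * (r + s + 2 * r * s))       ∎)
  where
    open ≡-Reasoning
    regroup : ∀ A B r s → (A * suc (2 * r)) * (B * suc (2 * s)) ≡ (A * B) * suc (2 * (r + s + 2 * r * s))
    regroup = solve-∀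

pow-odd-unique : ∀ e f r s → 2 ^ e * suc (2 * r) ≡ 2 ^ f * suc (2 * s) → e ≡ f
pow-odd-unique zero zero r s eq = refl
pow-odd-unique zero (suc f) r s eq =
  ⊥-elim (even≢odd (2 ^ f * suc (2 * s)) r (trans (sym (*-assoc 2 (2 ^ f) _)) (trans (sym eq) (*-identityˡ _))))
pow-odd-unique (suc e) zero r s eq =
  ⊥-elim (even≢odd (2 ^ e * suc (2 * r)) s (trans (sym (*-assoc 2 (2 ^ e) _)) (trans eq (*-identityˡ _))))
pow-odd-unique (suc e) (suc f) r s eq = cong suc (pow-odd-unique e f r s
  (*-cancelˡ-≡ _ _ 2 (trans (sym (*-assoc 2 (2 ^ e) _)) (trans eq (*-assoc 2 (2 ^ f) _)))))

ord₂-unique : ∀ {x e f} → Ord₂ x e → Ord₂ x f → e ≡ f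
ord₂-unique {e = e} {f} (ord₂ r refl) (ord₂ s eq) = pow-odd-unique e f r s eq

ord₂-nonZero : ∀ {x e} → Ord₂ x e → NonZero x
ord₂-nonZero {e = e} (ord₂ r refl) = m*n≢0 (2 ^ e) (suc (2 * r)) {{m^n≢0 2 e}}

ord₂-exists : ∀ x → NonZero x → ∃ (Ord₂ x)
ord₂-exists = <-rec (λ x → NonZero x → ∃ (Ord₂ x)) step
  where
    step : ∀ x → (∀ {y} → y < x → NonZero y → ∃ (Ord₂ y)) → NonZero x → ∃ (Ord₂ x)
    step x rec x≢0 with parity x
    ... | odd h = 0 , ord₂ h (sym (*-identityˡ _))
    ... | even zero = ⊥-elim (NonZero.nonZero x≢0)
    ... | even (suc h) with rec (m<m+n (suc h) z<s) _
    ...   | e , ord₂ r eq = suc e , ord₂ r (trans (cong (2 *_) eq) (sym (*-assoc 2 (2 ^ e) _)))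

ord₂-0⇒odd : ∀ {q} → Ord₂ q 0 → q % 2 ≡ 1
ord₂-0⇒odd (ord₂ r refl) = trans (cong (_% 2) (cong suc (trans (*-identityˡ _) (*-comm 2 r)))) ([m+kn]%n≡m%n 1 r 2)

odd⇒ord₂-0 : ∀ q → q % 2 ≡ 1 → Ord₂ q 0
odd⇒ord₂-0 q q%2≡1 = ord₂ (q / 2) (begin
  q                     ≡⟨ m≡m%n+[m/n]*n q 2 ⟩
  q % 2 + q / 2 * 2     ≡⟨ cong (_+ q / 2 * 2) q%2≡1 ⟩
  suc (q / 2 * 2)       ≡⟨ cong suc (*-comm (q / 2) 2) ⟩
  suc (2 * (q / 2))     ≡⟨ sym (*-identityˡ _) ⟩
  1 * suc (2 * (q / 2)) ∎)
  where open ≡-Reasoning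

odd⇔same-ord₂ : ∀ {q D M c d} → q * D ≡ M → Ord₂ D d → Ord₂ M c → (q % 2 ≡ 1 ⇔ c ≡ d)
odd⇔same-ord₂ {q} {D} {M} {c} {d} qD≡M ordD ordM = mk⇔ odd⇒same same⇒odd
  where
    ord-product : ∀ {e} → Ord₂ q e → e + d ≡ c
    ord-product ordq = ord₂-unique (subst (λ x → Ord₂ x _) qD≡M (ord₂-* ordq ordD)) ordM
    odd⇒same : q % 2 ≡ 1 → c ≡ d
    odd⇒same q-odd = sym (ord-product (odd⇒ord₂-0 q q-odd))
    q≢0 : NonZero q
    q≢0 = m*n≢0⇒m≢0 q {{subst NonZero (sym qD≡M) (ord₂-nonZero ordM)}}
    same⇒odd : c ≡ d → q % 2 ≡ 1
    same⇒odd c≡d with ord₂-exists q q≢0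
    ... | e , ordq = ord₂-0⇒odd (subst (Ord₂ q) (+-cancelʳ-≡ d e 0 (trans (ord-product ordq) c≡d)) ordq)

-- legendre m = ⌊m/2⌋ + ⌊m/4⌋ + ⌊m/8⌋ + ⋯, the 2-adic order of m! by Legendre's
-- formula.  It is computed by iterated halving with fuel; fuel m suffices.
legendreFuel : ℕ → ℕ → ℕ
legendreFuel zero m = 0
legendreFuel (suc f) m = ⌊ m /2⌋ + legendreFuel f ⌊ m /2⌋

legendre : ℕ → ℕ
legendre m = legendreFuel m m

legendreFuel-0 : ∀ f → legendreFuel f 0 ≡ 0
legendreFuel-0 zero = refl
legendreFuel-0 (suc f) = legendreFuel-0 f

half≤pred : ∀ m f → m ≤ suc f → ⌊ m /2⌋ ≤ f
half≤pred zero f _ = z≤n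
half≤pred (suc m) f (s≤s m≤f) = ≤-trans (≤-pred (⌊n/2⌋<n m)) m≤f

legendreFuel-stable : ∀ f g m → m ≤ f → m ≤ g → legendreFuel f m ≡ legendreFuel g m
legendreFuel-stable zero g zero _ _ = sym (legendreFuel-0 g)
legendreFuel-stable (suc f) zero zero _ _ = legendreFuel-0 (suc f)
legendreFuel-stable (suc f) (suc g) m m≤f m≤g =
  cong (⌊ m /2⌋ +_) (legendreFuel-stable f g ⌊ m /2⌋ (half≤pred m f m≤f) (half≤pred m g m≤g))

legendreFuel-mono : ∀ f {a b} → a ≤ b → legendreFuel f a ≤ legendreFuel f b
legendreFuel-mono zero _ = z≤n
legendreFuel-mono (suc f) a≤b = +-mono-≤ (⌊n/2⌋-mono a≤b) (legendreFuel-mono f (⌊n/2⌋-mono a≤b))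

half-superadditive : ∀ a b → ⌊ a /2⌋ + ⌊ b /2⌋ ≤ ⌊ a + b /2⌋
half-superadditive zero b = ≤-refl
half-superadditive (suc zero) b = ⌊n/2⌋-mono (n≤1+n b)
half-superadditive (suc (suc a)) b = s≤s (half-superadditive a b)

legendreFuel-superadditive : ∀ f a b → legendreFuel f a + legendreFuel f b ≤ legendreFuel f (a + b)
legendreFuel-superadditive zero a b = z≤n
legendreFuel-superadditive (suc f) a b = begin
  (⌊ a /2⌋ + legendreFuel f ⌊ a /2⌋) + (⌊ b /2⌋ + legendreFuel f ⌊ b /2⌋)
    ≡⟨ interchange ⌊ a /2⌋ (legendreFuel f ⌊ a /2⌋) ⌊ b /2⌋ (legendreFuel f ⌊ b /2⌋) ⟩
  (⌊ a /2⌋ + ⌊ b /2⌋) + (legendreFuel f ⌊ a /2⌋ + legendreFuel f ⌊ b /2⌋)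
    ≤⟨ +-monoʳ-≤ (⌊ a /2⌋ + ⌊ b /2⌋) (legendreFuel-superadditive f ⌊ a /2⌋ ⌊ b /2⌋) ⟩
  (⌊ a /2⌋ + ⌊ b /2⌋) + legendreFuel f (⌊ a /2⌋ + ⌊ b /2⌋)
    ≤⟨ +-mono-≤ (half-superadditive a b) (legendreFuel-mono f (half-superadditive a b)) ⟩
  ⌊ a + b /2⌋ + legendreFuel f ⌊ a + b /2⌋ ∎
  where
    open ≤-Reasoning
    interchange : ∀ a b c d → (a + b) + (c + d) ≡ (a + c) + (b + d)
    interchange = solve-∀

legendreFuel-suc≤ : ∀ f m → legendreFuel f (suc m) ≤ m
legendreFuel-suc≤ zero m = z≤n
legendreFuel-suc≤ (suc f) zero = ≤-reflexive (legendreFuel-0 f)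
legendreFuel-suc≤ (suc f) (suc m) = s≤s (begin
  ⌊ m /2⌋ + legendreFuel f (suc ⌊ m /2⌋) ≤⟨ +-monoʳ-≤ ⌊ m /2⌋ (legendreFuel-suc≤ f ⌊ m /2⌋) ⟩
  ⌊ m /2⌋ + ⌊ m /2⌋                       ≤⟨ +-monoʳ-≤ ⌊ m /2⌋ (⌊n/2⌋≤⌈n/2⌉ m) ⟩
  ⌊ m /2⌋ + ⌈ m /2⌉                       ≡⟨ ⌊n/2⌋+⌈n/2⌉≡n m ⟩
  m                                       ∎)
  where open ≤-Reasoning

legendre-mono : ∀ {a b} → a ≤ b → legendre a ≤ legendre b
legendre-mono {a} {b} a≤b =
  ≤-trans (≤-reflexive (legendreFuel-stable a b a ≤-refl a≤b)) (legendreFuel-mono b a≤b)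

legendre-superadditive : ∀ a b → legendre a + legendre b ≤ legendre (a + b)
legendre-superadditive a b = ≤-trans
  (≤-reflexive (cong₂ _+_ (legendreFuel-stable a (a + b) a ≤-refl (m≤m+n a b))
                          (legendreFuel-stable b (a + b) b ≤-refl (m≤n+m b a))))
  (legendreFuel-superadditive (a + b) a b)

legendre-suc≤ : ∀ m → legendre (suc m) ≤ m
legendre-suc≤ m = legendreFuel-suc≤ (suc m) m

legendre-double : ∀ m → legendre (2 * m) ≡ m + legendre m
legendre-double m = trans (cong legendre (twice m)) (doubled m)
  where
    doubled : ∀ m → legendre (m + m) ≡ m + legendre m
    doubled zero = refl
    doubled (suc m) =
      trans (cong (λ h → h + legendreFuel (m + suc m) h) (sym (n≡⌊n+n/2⌋ (suc m))))
            (cong (suc m +_) (legendreFuel-stable (m + suc m) (suc m) (suc m) (m≤n+m (suc m) m) ≤-refl))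

legendre-double+1 : ∀ m → legendre (suc (2 * m)) ≡ m + legendre m
legendre-double+1 m = trans (cong (legendre ∘ suc) (twice m))
  (trans (cong (λ h → h + legendreFuel (m + m) h) (sym (n≡⌈n+n/2⌉ m)))
         (cong (m +_) (legendreFuel-stable (m + m) m m (m≤m+n m m) ≤-refl)))

-- Strict superadditivity ν₂(a!) + ν₂(b!) < ν₂((a+b)!), i.e. a binomial (a+b choose a) is even.
LegendreStrict : ℕ → ℕ → Set
LegendreStrict a b = legendre a + legendre b < legendre (a + b)

-- Two odd numbers: adding them produces a carry.
legendreStrict-odd : ∀ α β → LegendreStrict (suc (2 * α)) (suc (2 * β))
legendreStrict-odd α β = begin-strict
  legendre (suc (2 * α)) + legendre (suc (2 * β))
    ≡⟨ cong₂ _+_ (legendre-double+1 α) (legendre-double+1 β) ⟩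
  (α + legendre α) + (β + legendre β)
    ≡⟨ interchange α (legendre α) β (legendre β) ⟩
  (α + β) + (legendre α + legendre β)
    ≤⟨ +-monoʳ-≤ (α + β) (legendre-superadditive α β) ⟩
  (α + β) + legendre (α + β)
    <⟨ s≤s (+-monoʳ-≤ (α + β) (legendre-mono (n≤1+n (α + β)))) ⟩
  suc (α + β) + legendre (suc (α + β))
    ≡⟨ sym (legendre-double (suc (α + β))) ⟩
  legendre (2 * suc (α + β))
    ≡⟨ cong legendre (sum-of-odds α β) ⟩
  legendre (suc (2 * α) + suc (2 * β)) ∎
  where
    open ≤-Reasoning
    interchange : ∀ a b c d → (a + b) + (c + d) ≡ (a + c) + (b + d)
    interchange = solve-∀
    sum-of-odds : ∀ α β → 2 * suc (α + β) ≡ suc (2 * α) + suc (2 * β)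
    sum-of-odds = solve-∀

legendreStrict-double : ∀ a b → LegendreStrict a b → LegendreStrict (2 * a) (2 * b)
legendreStrict-double a b a+b-strict = begin-strict
  legendre (2 * a) + legendre (2 * b)  ≡⟨ cong₂ _+_ (legendre-double a) (legendre-double b) ⟩
  (a + legendre a) + (b + legendre b)  ≡⟨ interchange a (legendre a) b (legendre b) ⟩
  (a + b) + (legendre a + legendre b)  <⟨ +-monoʳ-< (a + b) a+b-strict ⟩
  (a + b) + legendre (a + b)           ≡⟨ sym (legendre-double (a + b)) ⟩
  legendre (2 * (a + b))               ≡⟨ cong legendre (*-distribˡ-+ 2 a b) ⟩
  legendre (2 * a + 2 * b)             ∎
  where
    open ≤-Reasoning
    interchange : ∀ a b c d → (a + b) + (c + d) ≡ (a + c) + (b + d)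
    interchange = solve-∀

legendreStrict-scale : ∀ e a b → LegendreStrict a b → LegendreStrict (2 ^ e * a) (2 ^ e * b)
legendreStrict-scale zero a b strict =
  subst₂ LegendreStrict (sym (*-identityˡ a)) (sym (*-identityˡ b)) strict
legendreStrict-scale (suc e) a b strict =
  subst₂ LegendreStrict (sym (*-assoc 2 (2 ^ e) a)) (sym (*-assoc 2 (2 ^ e) b))
    (legendreStrict-double (2 ^ e * a) (2 ^ e * b) (legendreStrict-scale e a b strict))

-- For u > 0: ν₂(u!) + ν₂((7u)!) < ν₂((8u)!), since the odd parts of u and 7u are odd.
legendreStrict-1+7 : ∀ u → NonZero u → LegendreStrict u (7 * u)
legendreStrict-1+7 u u≢0 with ord₂-exists u u≢0
... | e , ord₂ r refl = subst (LegendreStrict (2 ^ e * x)) (*-comm-7 (2 ^ e) x)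
        (legendreStrict-scale e x (7 * x)
          (subst (LegendreStrict x) (seven-times-odd r) (legendreStrict-odd r (3 + 7 * r))))
  where
    x = suc (2 * r)
    seven-times-odd : ∀ r → suc (2 * (3 + 7 * r)) ≡ 7 * suc (2 * r)
    seven-times-odd = solve-∀
    *-comm-7 : ∀ A x → A * (7 * x) ≡ 7 * (A * x)
    *-comm-7 = solve-∀

legendre-pow2 : ∀ j → legendre (2 ^ j) + 1 ≡ 2 ^ j
legendre-pow2 zero = refl
legendre-pow2 (suc j) = begin
  legendre (2 * 2 ^ j) + 1       ≡⟨ cong (_+ 1) (legendre-double (2 ^ j)) ⟩
  (2 ^ j + legendre (2 ^ j)) + 1 ≡⟨ +-assoc (2 ^ j) (legendre (2 ^ j)) 1 ⟩
  2 ^ j + (legendre (2 ^ j) + 1) ≡⟨ cong (2 ^ j +_) (legendre-pow2 j) ⟩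
  2 ^ j + 2 ^ j                  ≡⟨ sym (twice (2 ^ j)) ⟩
  2 * 2 ^ j                      ∎
  where open ≡-Reasoning

legendre-fixpoint : ∀ r → legendre r ≡ r → r ≡ 0
legendre-fixpoint zero _ = refl
legendre-fixpoint (suc r) eq = ⊥-elim (1+n≰n (subst (_≤ r) eq (legendre-suc≤ r)))

legendre-deficit-one : ∀ e r → legendre (2 ^ e * suc (2 * r)) + 1 ≡ 2 ^ e * suc (2 * r) → r ≡ 0
legendre-deficit-one zero r eq = legendre-fixpoint r (+-cancelʳ-≡ 1 (legendre r) r (+-cancelˡ-≡ r _ _ (begin
  r + (legendre r + 1)         ≡⟨ sym (+-assoc r (legendre r) 1) ⟩
  (r + legendre r) + 1         ≡⟨ cong (_+ 1) (sym (legendre-double+1 r)) ⟩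
  legendre x + 1               ≡⟨ subst (λ z → legendre z + 1 ≡ z) (*-identityˡ x) eq ⟩
  x                            ≡⟨ odd-as-sum r ⟩
  r + (r + 1)                  ∎)))
  where
    open ≡-Reasoning
    x = suc (2 * r)
    odd-as-sum : ∀ r → suc (2 * r) ≡ r + (r + 1)
    odd-as-sum = solve-∀
legendre-deficit-one (suc e) r eq = legendre-deficit-one e r (+-cancelˡ-≡ y _ _ (begin
  y + (legendre y + 1)         ≡⟨ sym (+-assoc y (legendre y) 1) ⟩
  (y + legendre y) + 1         ≡⟨ cong (_+ 1) (sym (legendre-double y)) ⟩
  legendre (2 * y) + 1         ≡⟨ subst (λ z → legendre z + 1 ≡ z) (*-assoc 2 (2 ^ e) _) eq ⟩
  2 * y                        ≡⟨ twice y ⟩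
  y + y                        ∎))
  where
    open ≡-Reasoning
    y = 2 ^ e * suc (2 * r)

legendre-pow2⇔ : ∀ w → legendre (suc w) ≡ w ⇔ ∃ λ j → suc w ≡ 2 ^ j
legendre-pow2⇔ w = mk⇔ to from
  where
    to : legendre (suc w) ≡ w → ∃ λ j → suc w ≡ 2 ^ j
    to eq with ord₂-exists (suc w) _
    ... | e , ord₂ r decomp with legendre-deficit-one e r
            (subst (λ z → legendre z + 1 ≡ z) decomp (trans (cong (_+ 1) eq) (+-comm w 1)))
    ...   | refl = e , trans decomp (*-identityʳ (2 ^ e))
    from : (∃ λ j → suc w ≡ 2 ^ j) → legendre (suc w) ≡ w
    from (j , eq) = suc-injective (begin
      suc (legendre (suc w))  ≡⟨ +-comm 1 (legendre (suc w)) ⟩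
      legendre (suc w) + 1    ≡⟨ cong (λ z → legendre z + 1) eq ⟩
      legendre (2 ^ j) + 1    ≡⟨ legendre-pow2 j ⟩
      2 ^ j                   ≡⟨ sym eq ⟩
      suc w                   ∎)
      where open ≡-Reasoning

along-period : ∀ (P : ℕ → Set) p → (∀ n → P n → P (p + n)) → ∀ c → P c → ∀ m → P (c + p * m)
along-period P p step c Pc zero = subst P (sym (trans (cong (c +_) (*-zeroʳ p)) (+-identityʳ c))) Pc
along-period P p step c Pc (suc m) =
  subst P (shift c p m) (step (c + p * m) (along-period P p step c Pc m))
  where
    shift : ∀ c p m → p + (c + p * m) ≡ c + p * suc m
    shift = solve-∀

-- s_{n+3} = 2 s_{n+1} + s_n, so oddness of a Fibonacci-like sequence has period 3.
ord₂-period3 : ∀ s → IsFibLike s → ∀ n → Ord₂ (s n) 0 → Ord₂ (s (3 + n)) 0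
ord₂-period3 s rec n (ord₂ r eq) = ord₂ (s (suc n) + r) (begin
  s (3 + n)                           ≡⟨ fibLike-shift s rec 2 n ⟩
  2 * s (suc n) + 1 * s n             ≡⟨ cong (λ x → 2 * s (suc n) + 1 * x) eq ⟩
  2 * s (suc n) + 1 * (1 * suc (2 * r)) ≡⟨ collect (s (suc n)) r ⟩
  1 * suc (2 * (s (suc n) + r))       ∎)
  where
    open ≡-Reasoning
    collect : ∀ y r → 2 * y + 1 * (1 * suc (2 * r)) ≡ 1 * suc (2 * (y + r))
    collect = solve-∀

-- s_{n+6} = 8 s_{n+1} + 5 s_n, so a 2-adic order at most 2 has period 6.
ord₂-period6 : ∀ s → IsFibLike s → ∀ e → e ≤ 2 → ∀ n → Ord₂ (s n) e → Ord₂ (s (6 + n)) e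
ord₂-period6 s rec e e≤2 n (ord₂ r eq) with m≤n⇒∃[o]m+o≡n e≤2
... | d , e+d≡2 = ord₂ (2 ^ d * s (suc n) + 5 * r + 2) (begin
  s (6 + n)                                   ≡⟨ fibLike-shift s rec 5 n ⟩
  8 * s (suc n) + 5 * s n                     ≡⟨ cong₂ (λ k x → k * s (suc n) + 5 * x) eight eq ⟩
  2 * (2 ^ e * 2 ^ d) * s (suc n) + 5 * (2 ^ e * suc (2 * r))
                                              ≡⟨ collect (2 ^ e) (2 ^ d) (s (suc n)) r ⟩
  2 ^ e * suc (2 * (2 ^ d * s (suc n) + 5 * r + 2)) ∎)
  where
    open ≡-Reasoning
    eight : 8 ≡ 2 * (2 ^ e * 2 ^ d)
    eight = trans (cong (λ k → 2 * 2 ^ k) (sym e+d≡2)) (cong (2 *_) (^-distribˡ-+-* 2 e d))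
    collect : ∀ A D y r → 2 * (A * D) * y + 5 * (A * suc (2 * r)) ≡ A * suc (2 * (D * y + 5 * r + 2))
    collect = solve-∀

fib-3m+1-odd : ∀ m → Ord₂ (fib (1 + 3 * m)) 0
fib-3m+1-odd = along-period (λ i → Ord₂ (fib i) 0) 3 (ord₂-period3 fib (λ _ → refl)) 1 (ord₂ 0 refl)

fib-3m+2-odd : ∀ m → Ord₂ (fib (2 + 3 * m)) 0
fib-3m+2-odd = along-period (λ i → Ord₂ (fib i) 0) 3 (ord₂-period3 fib (λ _ → refl)) 2 (ord₂ 0 refl)

fib-6m+3-ord : ∀ m → Ord₂ (fib (3 + 6 * m)) 1
fib-6m+3-ord = along-period (λ i → Ord₂ (fib i) 1) 6 (ord₂-period6 fib (λ _ → refl) 1 (s≤s z≤n)) 3 (ord₂ 0 refl)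

lucas-6m+3-ord : ∀ m → Ord₂ (lucas (3 + 6 * m)) 2
lucas-6m+3-ord = along-period (λ i → Ord₂ (lucas i) 2) 6 (ord₂-period6 lucas (λ _ → refl) 2 ≤-refl) 3 (ord₂ 0 refl)

lucas-6m+6-ord : ∀ m → Ord₂ (lucas (6 + 6 * m)) 1
lucas-6m+6-ord = along-period (λ i → Ord₂ (lucas i) 1) 6 (ord₂-period6 lucas (λ _ → refl) 1 (s≤s z≤n)) 6 (ord₂ 4 refl)

-- prodOrd M = ν₂(M!) + M + ⌊M/2⌋; this is the 2-adic order of F_1⋯F_{3M}
-- (ord-fibProd3 below).  It is the sum of ν₂(F_{3k}) = 1 (k odd), ν₂(k) + 2 (k even).
prodOrd : ℕ → ℕ
prodOrd M = legendre M + M + ⌊ M /2⌋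

half-double : ∀ m → ⌊ 2 * m /2⌋ ≡ m
half-double m = trans (cong ⌊_/2⌋ (twice m)) (sym (n≡⌊n+n/2⌋ m))

half-double+1 : ∀ m → ⌊ suc (2 * m) /2⌋ ≡ m
half-double+1 m = trans (cong (⌊_/2⌋ ∘ suc) (twice m)) (sym (n≡⌈n+n/2⌉ m))

prodOrd-double : ∀ m → prodOrd (2 * m) ≡ 4 * m + legendre m
prodOrd-double m rewrite legendre-double m | half-double m = rearrange m (legendre m)
  where
    rearrange : ∀ m v → m + v + 2 * m + m ≡ 4 * m + v
    rearrange = solve-∀

prodOrd-double+1 : ∀ m → prodOrd (suc (2 * m)) ≡ suc (4 * m + legendre m)
prodOrd-double+1 m rewrite legendre-double+1 m | half-double+1 m = rearrange m (legendre m)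
  where
    rearrange : ∀ m v → m + v + suc (2 * m) + m ≡ suc (4 * m + v)
    rearrange = solve-∀

fib-odd-step : ∀ m → Ord₂ (fib (3 * suc (2 * m))) 1 × prodOrd (suc (2 * m)) ≡ prodOrd (2 * m) + 1
fib-odd-step m =
  subst (λ i → Ord₂ (fib i) 1) (index m) (fib-6m+3-ord m) ,
  trans (prodOrd-double+1 m) (trans (cong suc (sym (prodOrd-double m))) (+-comm 1 (prodOrd (2 * m))))
  where
    index : ∀ m → 3 + 6 * m ≡ 3 * suc (2 * m)
    index = solve-∀

-- The Lucas factor of F_{6(m+1)} = F_{3(m+1)} L_{3(m+1)}: its 2-adic order ℓ (2 for m even,
-- 1 for m odd) is exactly what the step at the even index 2(m+1) adds to the step at m+1.
lucas-step : ∀ m → ∃ λ ℓ → Ord₂ (lucas (3 * suc m)) ℓ ×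
  prodOrd (2 * suc m) + prodOrd m ≡ prodOrd (suc (2 * m)) + prodOrd (suc m) + ℓ
lucas-step m with parity m
... | even p = 2 , subst (λ i → Ord₂ (lucas i) 2) (index p) (lucas-6m+3-ord p) , (begin
  prodOrd (2 * suc (2 * p)) + prodOrd (2 * p)
    ≡⟨ cong₂ _+_ (trans (prodOrd-double (suc (2 * p))) (cong (4 * suc (2 * p) +_) (legendre-double+1 p)))
                 (prodOrd-double p) ⟩
  4 * suc (2 * p) + (p + legendre p) + (4 * p + legendre p)
    ≡⟨ rearrange p (legendre p) ⟩
  suc (4 * (2 * p) + (p + legendre p)) + suc (4 * p + legendre p) + 2
    ≡⟨ cong₂ (λ x y → x + y + 2)
         (trans (cong (λ v → suc (4 * (2 * p) + v)) (sym (legendre-double p))) (sym (prodOrd-double+1 (2 * p))))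
         (sym (prodOrd-double+1 p)) ⟩
  prodOrd (suc (2 * (2 * p))) + prodOrd (suc (2 * p)) + 2 ∎)
  where
    open ≡-Reasoning
    index : ∀ p → 3 + 6 * p ≡ 3 * suc (2 * p)
    index = solve-∀
    rearrange : ∀ p v → 4 * suc (2 * p) + (p + v) + (4 * p + v) ≡ suc (4 * (2 * p) + (p + v)) + suc (4 * p + v) + 2
    rearrange = solve-∀
... | odd p = 1 , subst (λ i → Ord₂ (lucas i) 1) (index p) (lucas-6m+6-ord p) , (begin
  prodOrd (2 * suc (suc (2 * p))) + prodOrd (suc (2 * p))
    ≡⟨ cong₂ _+_ (trans (prodOrd-double (suc (suc (2 * p))))
                        (cong (4 * suc (suc (2 * p)) +_) (trans (cong legendre (double-suc p)) (legendre-double (suc p)))))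
                 (prodOrd-double+1 p) ⟩
  4 * suc (suc (2 * p)) + (suc p + legendre (suc p)) + suc (4 * p + legendre p)
    ≡⟨ rearrange p (legendre p) (legendre (suc p)) ⟩
  suc (4 * suc (2 * p) + (p + legendre p)) + (4 * suc p + legendre (suc p)) + 1
    ≡⟨ cong₂ (λ x y → x + y + 1)
         (trans (cong (λ v → suc (4 * suc (2 * p) + v)) (sym (legendre-double+1 p))) (sym (prodOrd-double+1 (suc (2 * p)))))
         (sym (trans (cong prodOrd (double-suc p)) (prodOrd-double (suc p)))) ⟩
  prodOrd (suc (2 * suc (2 * p))) + prodOrd (suc (suc (2 * p))) + 1 ∎)
  where
    open ≡-Reasoning
    index : ∀ p → 6 + 6 * p ≡ 3 * suc (suc (2 * p))
    index = solve-∀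
    rearrange : ∀ p v w → 4 * suc (suc (2 * p)) + (suc p + w) + suc (4 * p + v)
      ≡ suc (4 * suc (2 * p) + (p + v)) + (4 * suc p + w) + 1
    rearrange = solve-∀

-- ν₂(F_{3(M+1)}) = prodOrd (M+1) − prodOrd M, by strong induction on M: for M even
-- F_{3(M+1)} ≡ 2 (mod 4); for M = 2m+1, F_{6(m+1)} = F_{3(m+1)} L_{3(m+1)}.
fib3-ord : ∀ M → ∃ λ e → Ord₂ (fib (3 * suc M)) e × prodOrd (suc M) ≡ prodOrd M + e
fib3-ord = <-rec (λ M → ∃ λ e → Ord₂ (fib (3 * suc M)) e × prodOrd (suc M) ≡ prodOrd M + e) step
  where
    step : ∀ M → (∀ {m} → m < M → ∃ λ e → Ord₂ (fib (3 * suc m)) e × prodOrd (suc m) ≡ prodOrd m + e)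
         → ∃ λ e → Ord₂ (fib (3 * suc M)) e × prodOrd (suc M) ≡ prodOrd M + e
    step M rec with parity M
    ... | even m = 1 , fib-odd-step m
    ... | odd m with rec (s≤s (m≤m+n m (m + 0))) | lucas-step m
    ...   | e , ordF , stepF | ℓ , ordL , stepL =
      e + ℓ , subst (λ x → Ord₂ x (e + ℓ)) (sym doubling) (ord₂-* ordF ordL) ,
      +-cancelʳ-≡ (prodOrd m) _ _ (begin
        prodOrd (suc (suc (2 * m))) + prodOrd m            ≡⟨ cong (λ i → prodOrd i + prodOrd m) (double-suc m) ⟩
        prodOrd (2 * suc m) + prodOrd m                    ≡⟨ stepL ⟩
        prodOrd (suc (2 * m)) + prodOrd (suc m) + ℓ        ≡⟨ cong (λ x → prodOrd (suc (2 * m)) + x + ℓ) stepF ⟩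
        prodOrd (suc (2 * m)) + (prodOrd m + e) + ℓ        ≡⟨ rearrange (prodOrd (suc (2 * m))) (prodOrd m) e ℓ ⟩
        prodOrd (suc (2 * m)) + (e + ℓ) + prodOrd m        ∎)
      where
        open ≡-Reasoning
        doubling : fib (3 * suc (suc (2 * m))) ≡ fib (3 * suc m) * lucas (3 * suc m)
        doubling = trans (cong fib (index m)) (fib-double (3 * suc m))
          where
            index : ∀ m → 3 * suc (suc (2 * m)) ≡ 2 * (3 * suc m)
            index = solve-∀
        rearrange : ∀ a b e ℓ → a + (b + e) + ℓ ≡ a + (e + ℓ) + b
        rearrange = solve-∀

ord-fibProd3 : ∀ M → Ord₂ (fibProd (3 * M)) (prodOrd M)
ord-fibProd3 zero = ord₂ 0 refl
ord-fibProd3 (suc M) with fib3-ord M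
... | e , ordF , stepF = subst₂ Ord₂ (cong fibProd (sym (index M))) (trans (+-comm e (prodOrd M)) (sym stepF))
  (ord₂-* (subst (λ i → Ord₂ (fib i) e) (index M) ordF)
    (ord₂-* (fib-3m+2-odd M) (ord₂-* (fib-3m+1-odd M) (ord-fibProd3 M))))
  where
    index : ∀ M → 3 * suc M ≡ 3 + 3 * M
    index = solve-∀

-- Since F_{3M+1} and F_{3M+2} are odd: ν₂(F_1⋯F_j) = prodOrd M whenever j = r + 3M, r ≤ 2.
ord-fibProd : ∀ {j} r M → r ≤ 2 → j ≡ r + 3 * M → Ord₂ (fibProd j) (prodOrd M)
ord-fibProd 0 M _ refl = ord-fibProd3 M
ord-fibProd 1 M _ refl = ord₂-* (fib-3m+1-odd M) (ord-fibProd3 M)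
ord-fibProd 2 M _ refl = ord₂-* (fib-3m+2-odd M) (ord₂-* (fib-3m+1-odd M) (ord-fibProd3 M))
ord-fibProd (suc (suc (suc r))) M (s≤s (s≤s ())) _

prodOrd-superadditive : ∀ A B → prodOrd A + prodOrd B ≤ prodOrd (A + B)
prodOrd-superadditive A B = begin
  (legendre A + A + ⌊ A /2⌋) + (legendre B + B + ⌊ B /2⌋)
    ≡⟨ regroup (legendre A) A ⌊ A /2⌋ (legendre B) B ⌊ B /2⌋ ⟩
  (legendre A + legendre B) + (A + B) + (⌊ A /2⌋ + ⌊ B /2⌋)
    ≤⟨ +-mono-≤ (+-monoˡ-≤ (A + B) (legendre-superadditive A B)) (half-superadditive A B) ⟩
  legendre (A + B) + (A + B) + ⌊ A + B /2⌋ ∎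
  where
    open ≤-Reasoning
    regroup : ∀ v a h w b k → (v + a + h) + (w + b + k) ≡ (v + w) + (a + b) + (h + k)
    regroup = solve-∀

prodOrd-< : ∀ {A C} → A < C → prodOrd A < prodOrd C
prodOrd-< A<C =
  +-mono-<-≤ (+-mono-≤-< (legendre-mono (<⇒≤ A<C)) A<C) (⌊n/2⌋-mono (<⇒≤ A<C))

prodOrd-gap : ∀ A B C → A + B < C → prodOrd A + prodOrd B < prodOrd C
prodOrd-gap A B C A+B<C = ≤-<-trans (prodOrd-superadditive A B) (prodOrd-< A+B<C)

-- Two odd arguments lose the carry of ⌊·/2⌋, so superadditivity is strict.
prodOrd-strict-odd : ∀ α β → prodOrd (suc (2 * α)) + prodOrd (suc (2 * β)) < prodOrd (suc (2 * α) + suc (2 * β))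
prodOrd-strict-odd α β = begin-strict
  prodOrd (suc (2 * α)) + prodOrd (suc (2 * β))
    ≡⟨ cong₂ _+_ (prodOrd-double+1 α) (prodOrd-double+1 β) ⟩
  suc (4 * α + legendre α) + suc (4 * β + legendre β)
    ≡⟨ regroup α β (legendre α) (legendre β) ⟩
  2 + 4 * (α + β) + (legendre α + legendre β)
    <⟨ +-mono-<-≤ (+-monoˡ-< (4 * (α + β)) {2} {4} (s≤s (s≤s (s≤s z≤n))))
                  (≤-trans (legendre-superadditive α β) (legendre-mono (n≤1+n (α + β)))) ⟩
  4 + 4 * (α + β) + legendre (suc (α + β))
    ≡⟨ cong (_+ legendre (suc (α + β))) (four-suc (α + β)) ⟩
  4 * suc (α + β) + legendre (suc (α + β))
    ≡⟨ sym (prodOrd-double (suc (α + β))) ⟩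
  prodOrd (2 * suc (α + β))
    ≡⟨ cong prodOrd (sum-of-odds α β) ⟩
  prodOrd (suc (2 * α) + suc (2 * β)) ∎
  where
    open ≤-Reasoning
    regroup : ∀ α β v w → suc (4 * α + v) + suc (4 * β + w) ≡ 2 + 4 * (α + β) + (v + w)
    regroup = solve-∀
    four-suc : ∀ x → 4 + 4 * x ≡ 4 * suc x
    four-suc = solve-∀
    sum-of-odds : ∀ α β → 2 * suc (α + β) ≡ suc (2 * α) + suc (2 * β)
    sum-of-odds = solve-∀

data Residue (d : ℕ) : ℕ → Set where
  residue : ∀ r q → r < d → Residue d (r + d * q)

residue-view : ∀ d .{{_ : NonZero d}} n → Residue d n
residue-view d n = subst (Residue d) (sym decomposition) (residue (n % d) (n / d) (m%n<n n d))
  where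
    decomposition : n ≡ n % d + d * (n / d)
    decomposition = trans (m≡m%n+[m/n]*n n d) (cong (n % d +_) (*-comm (n / d) d))

residue-% : ∀ d .{{_ : NonZero d}} r q → r < d → (r + d * q) % d ≡ r
residue-% d r q r<d =
  trans (cong (λ x → (r + x) % d) (*-comm d q)) (trans ([m+kn]%n≡m%n r q d) (m<n⇒m%n≡m r<d))

remainder-unique : ∀ d .{{_ : NonZero d}} {r s} u v → r < d → s < d → r + d * u ≡ s + d * v → r ≡ s
remainder-unique d {r} {s} u v r<d s<d eq =
  trans (sym (residue-% d r u r<d)) (trans (cong (_% d) eq) (residue-% d s v s<d))

Exceptional : ℕ → Set
Exceptional n = ∃ λ (k : ℕ) → 1 ≤ k × k % 3 ≡ 1 × 7 * n ≡ 1 + 3 * 2 ^ k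

-- 7n ≡ 1 (mod 6) for an exceptional n, hence n ≡ 1 (mod 6).
exceptional⇒1mod6 : ∀ n → Exceptional n → n % 6 ≡ 1
exceptional⇒1mod6 n (zero , () , _)
exceptional⇒1mod6 n (suc j , _ , _ , eq) = begin
  n % 6                 ≡⟨ sym ([m+kn]%n≡m%n n n 6) ⟩
  (n + n * 6) % 6       ≡⟨ cong (_% 6) (trans (seven-times n) (trans eq (six-times (2 ^ j)))) ⟩
  (1 + 2 ^ j * 6) % 6   ≡⟨ [m+kn]%n≡m%n 1 (2 ^ j) 6 ⟩
  1                     ∎
  where
    open ≡-Reasoning
    seven-times : ∀ n → n + n * 6 ≡ 7 * n
    seven-times = solve-∀
    six-times : ∀ y → 1 + 3 * (2 * y) ≡ 1 + y * 6
    six-times = solve-∀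

-- 2^3 ≡ 1 (mod 7), so 2^{s+3q} ≡ 2^s (mod 7).
pow2-mod7 : ∀ s q → ∃ λ Y → 2 ^ (s + 3 * q) ≡ 2 ^ s + 7 * Y
pow2-mod7 s = along-period (λ i → ∃ λ Y → 2 ^ i ≡ 2 ^ s + 7 * Y) 3 step s (0 , sym (+-identityʳ _))
  where
    step : ∀ i → (∃ λ Y → 2 ^ i ≡ 2 ^ s + 7 * Y) → ∃ λ Y → 2 ^ (3 + i) ≡ 2 ^ s + 7 * Y
    step i (Y , eq) = 2 ^ s + 8 * Y , trans (cong (λ z → 2 * (2 * (2 * z))) eq) (eight-times (2 ^ s) Y)
      where
        eight-times : ∀ A Y → 2 * (2 * (2 * (A + 7 * Y))) ≡ A + 7 * (A + 8 * Y)
        eight-times = solve-∀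

pow2-not-1mod7 : ∀ s q u → 2 ^ s < 7 → 2 ^ s ≢ 1 → suc (7 * u) ≢ 2 ^ (s + 3 * q)
pow2-not-1mod7 s q u 2^s<7 2^s≢1 eq with pow2-mod7 s q
... | Y , eqY = 2^s≢1 (sym (remainder-unique 7 u Y (s≤s (s≤s z≤n)) 2^s<7 (trans eq eqY)))

-- If 2^j ≡ 1 (mod 7) then 3 ∣ j, i.e. j + 1 ≡ 1 (mod 3).
pow2≡1mod7⇒ : ∀ j u → suc (7 * u) ≡ 2 ^ j → suc j % 3 ≡ 1
pow2≡1mod7⇒ j u eq with residue-view 3 j
... | residue 0 q _ = trans (cong (λ x → suc x % 3) (*-comm 3 q)) ([m+kn]%n≡m%n 1 q 3)
... | residue 1 q _ = ⊥-elim (pow2-not-1mod7 1 q u (s≤s (s≤s (s≤s z≤n))) (λ ()) eq)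
... | residue 2 q _ = ⊥-elim (pow2-not-1mod7 2 q u (s≤s (s≤s (s≤s (s≤s (s≤s z≤n))))) (λ ()) eq)
... | residue (suc (suc (suc _))) _ (s≤s (s≤s (s≤s ())))

pow2⇔exceptional : ∀ u → (∃ λ j → suc (7 * u) ≡ 2 ^ j) ⇔ Exceptional (1 + 6 * u)
pow2⇔exceptional u = mk⇔ to from
  where
    rewrite-7n : ∀ u → 7 * (1 + 6 * u) ≡ 1 + 6 * suc (7 * u)
    rewrite-7n = solve-∀
    rewrite-2^k : ∀ y → 1 + 3 * (2 * y) ≡ 1 + 6 * y
    rewrite-2^k = solve-∀
    to : (∃ λ j → suc (7 * u) ≡ 2 ^ j) → Exceptional (1 + 6 * u)
    to (j , eq) = suc j , s≤s z≤n , pow2≡1mod7⇒ j u eq ,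
      trans (rewrite-7n u) (trans (cong (λ z → 1 + 6 * z) eq) (sym (rewrite-2^k (2 ^ j))))
    from : Exceptional (1 + 6 * u) → ∃ λ j → suc (7 * u) ≡ 2 ^ j
    from (zero , () , _)
    from (suc j , _ , _ , eq) =
      j , *-cancelˡ-≡ _ _ 6 (suc-injective (trans (sym (rewrite-7n u)) (trans eq (rewrite-2^k (2 ^ j)))))

legendre-8u+1 : ∀ u → legendre (suc (8 * u)) ≡ 7 * u + legendre u
legendre-8u+1 u = begin
  legendre (suc (8 * u))            ≡⟨ cong (legendre ∘ suc) (eight u) ⟩
  legendre (suc (2 * (4 * u)))      ≡⟨ legendre-double+1 (4 * u) ⟩
  4 * u + legendre (4 * u)          ≡⟨ cong (λ x → 4 * u + legendre x) (four u) ⟩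
  4 * u + legendre (2 * (2 * u))    ≡⟨ cong (4 * u +_) (legendre-double (2 * u)) ⟩
  4 * u + (2 * u + legendre (2 * u)) ≡⟨ cong (λ x → 4 * u + (2 * u + x)) (legendre-double u) ⟩
  4 * u + (2 * u + (u + legendre u)) ≡⟨ collect u (legendre u) ⟩
  7 * u + legendre u                ∎
  where
    open ≡-Reasoning
    eight : ∀ u → 8 * u ≡ 2 * (4 * u)
    eight = solve-∀
    four : ∀ u → 4 * u ≡ 2 * (2 * u)
    four = solve-∀
    collect : ∀ u v → 4 * u + (2 * u + (u + v)) ≡ 7 * u + v
    collect = solve-∀

-- For n = 6u + 1 the three products have orders prodOrd at 2u, 2(7u+1), 2(8u+1);
-- they balance exactly when ν₂((7u+1)!) = 7u.
balanced-1mod6 : ∀ u →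
  prodOrd (2 * suc (8 * u)) ≡ prodOrd (2 * u) + prodOrd (2 * suc (7 * u)) ⇔ legendre (suc (7 * u)) ≡ 7 * u
balanced-1mod6 u = mk⇔
  (λ balanced → sym (+-cancelˡ-≡ K _ _ (trans (sym ord-8n) (trans balanced ord-n+7n))))
  (λ eq → trans ord-8n (trans (cong (K +_) (sym eq)) (sym ord-n+7n)))
  where
    K = 32 * u + 4 + legendre u
    ord-8n : prodOrd (2 * suc (8 * u)) ≡ K + 7 * u
    ord-8n = trans (prodOrd-double (suc (8 * u)))
      (trans (cong (4 * suc (8 * u) +_) (legendre-8u+1 u)) (collect u (legendre u)))
      where
        collect : ∀ u v → 4 * suc (8 * u) + (7 * u + v) ≡ 32 * u + 4 + v + 7 * u
        collect = solve-∀
    ord-n+7n : prodOrd (2 * u) + prodOrd (2 * suc (7 * u)) ≡ K + legendre (suc (7 * u))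
    ord-n+7n = trans (cong₂ _+_ (prodOrd-double u) (prodOrd-double (suc (7 * u))))
      (collect u (legendre u) (legendre (suc (7 * u))))
      where
        collect : ∀ u v w → 4 * u + v + (4 * suc (7 * u) + w) ≡ 32 * u + 4 + v + w
        collect = solve-∀

-- The 2-adic orders a, b, c of F_1⋯F_n, F_1⋯F_{7n}, F_1⋯F_{8n}, together with the fact
-- that the balance c = a + b (which says (8n choose n)_F is odd) is the condition of the theorem.
record Criterion (n : ℕ) : Set where
  constructor criterion
  field
    a b c : ℕ
    ord-n : Ord₂ (fibProd n) a
    ord-7n : Ord₂ (fibProd (7 * n)) b
    ord-8n : Ord₂ (fibProd (8 * n)) c
    balanced⇔exceptional : c ≡ a + b ⇔ Exceptional n

unbalanced : ∀ r u {a b c} → r < 6 → r ≢ 1 →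
  Ord₂ (fibProd (r + 6 * u)) a → Ord₂ (fibProd (7 * (r + 6 * u))) b → Ord₂ (fibProd (8 * (r + 6 * u))) c →
  a + b < c → Criterion (r + 6 * u)
unbalanced r u r<6 r≢1 ord-n ord-7n ord-8n a+b<c = criterion _ _ _ ord-n ord-7n ord-8n (mk⇔
  (λ balanced → contradiction (sym balanced) (<⇒≢ a+b<c))
  (λ exceptional → contradiction (trans (sym (residue-% 6 r u r<6)) (exceptional⇒1mod6 (r + 6 * u) exceptional)) r≢1))

-- n = 6u (u > 0): the orders balance in the linear parts, but ν₂ of the factorials does not.
criterion-0 : ∀ u → NonZero u → Criterion (6 * u)
criterion-0 u u≢0 = unbalanced 0 u z<s (λ ()) 
  (ord-fibProd 0 (2 * u) z≤n (index-n u))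
  (ord-fibProd 0 (2 * (7 * u)) z≤n (index-7n u))
  (ord-fibProd 0 (2 * (8 * u)) z≤n (index-8n u))
  (begin-strict
    prodOrd (2 * u) + prodOrd (2 * (7 * u))
      ≡⟨ cong₂ _+_ (prodOrd-double u) (prodOrd-double (7 * u)) ⟩
    (4 * u + legendre u) + (4 * (7 * u) + legendre (7 * u))
      ≡⟨ regroup u (legendre u) (legendre (7 * u)) ⟩
    4 * (8 * u) + (legendre u + legendre (7 * u))
      <⟨ +-monoʳ-< (4 * (8 * u)) (legendreStrict-1+7 u u≢0) ⟩
    4 * (8 * u) + legendre (u + 7 * u)
      ≡⟨ cong (λ x → 4 * (8 * u) + legendre x) (one-plus-seven u) ⟩
    4 * (8 * u) + legendre (8 * u)
      ≡⟨ sym (prodOrd-double (8 * u)) ⟩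
    prodOrd (2 * (8 * u)) ∎)
  where
    open ≤-Reasoning
    index-n : ∀ u → 6 * u ≡ 0 + 3 * (2 * u)
    index-n = solve-∀
    index-7n : ∀ u → 7 * (6 * u) ≡ 0 + 3 * (2 * (7 * u))
    index-7n = solve-∀
    index-8n : ∀ u → 8 * (6 * u) ≡ 0 + 3 * (2 * (8 * u))
    index-8n = solve-∀
    regroup : ∀ u v w → (4 * u + v) + (4 * (7 * u) + w) ≡ 4 * (8 * u) + (v + w)
    regroup = solve-∀
    one-plus-seven : ∀ u → u + 7 * u ≡ 8 * u
    one-plus-seven = solve-∀

criterion-1 : ∀ u → Criterion (1 + 6 * u)
criterion-1 u = criterion _ _ _
  (ord-fibProd 1 (2 * u) (s≤s z≤n) (index-n u))
  (ord-fibProd 1 (2 * suc (7 * u)) (s≤s z≤n) (index-7n u))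
  (ord-fibProd 2 (2 * suc (8 * u)) (s≤s (s≤s z≤n)) (index-8n u))
  (pow2⇔exceptional u ⇔-∘ (legendre-pow2⇔ (7 * u) ⇔-∘ balanced-1mod6 u))
  where
    index-n : ∀ u → 1 + 6 * u ≡ 1 + 3 * (2 * u)
    index-n = solve-∀
    index-7n : ∀ u → 7 * (1 + 6 * u) ≡ 1 + 3 * (2 * suc (7 * u))
    index-7n = solve-∀
    index-8n : ∀ u → 8 * (1 + 6 * u) ≡ 2 + 3 * (2 * suc (8 * u))
    index-8n = solve-∀

-- n = 6u + 2 and n = 6u + 5: the index of F_1⋯F_{8n} exceeds the sum of the other two.
criterion-2 : ∀ u → Criterion (2 + 6 * u)
criterion-2 u = unbalanced 2 u (s≤s (s≤s (s≤s z≤n))) (λ ())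
  (ord-fibProd 2 (2 * u) (s≤s (s≤s z≤n)) (index-n u))
  (ord-fibProd 2 (14 * u + 4) (s≤s (s≤s z≤n)) (index-7n u))
  (ord-fibProd 1 (16 * u + 5) (s≤s z≤n) (index-8n u))
  (prodOrd-gap (2 * u) (14 * u + 4) (16 * u + 5) (≤-reflexive (gap u)))
  where
    index-n : ∀ u → 2 + 6 * u ≡ 2 + 3 * (2 * u)
    index-n = solve-∀
    index-7n : ∀ u → 7 * (2 + 6 * u) ≡ 2 + 3 * (14 * u + 4)
    index-7n = solve-∀
    index-8n : ∀ u → 8 * (2 + 6 * u) ≡ 1 + 3 * (16 * u + 5)
    index-8n = solve-∀
    gap : ∀ u → suc (2 * u + (14 * u + 4)) ≡ 16 * u + 5
    gap = solve-∀

criterion-5 : ∀ u → Criterion (5 + 6 * u)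
criterion-5 u = unbalanced 5 u ≤-refl (λ ())
  (ord-fibProd 2 (2 * u + 1) (s≤s (s≤s z≤n)) (index-n u))
  (ord-fibProd 2 (14 * u + 11) (s≤s (s≤s z≤n)) (index-7n u))
  (ord-fibProd 1 (16 * u + 13) (s≤s z≤n) (index-8n u))
  (prodOrd-gap (2 * u + 1) (14 * u + 11) (16 * u + 13) (≤-reflexive (gap u)))
  where
    index-n : ∀ u → 5 + 6 * u ≡ 2 + 3 * (2 * u + 1)
    index-n = solve-∀
    index-7n : ∀ u → 7 * (5 + 6 * u) ≡ 2 + 3 * (14 * u + 11)
    index-7n = solve-∀
    index-8n : ∀ u → 8 * (5 + 6 * u) ≡ 1 + 3 * (16 * u + 13)
    index-8n = solve-∀
    gap : ∀ u → suc (2 * u + 1 + (14 * u + 11)) ≡ 16 * u + 13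
    gap = solve-∀

-- n = 6u + 3 and n = 6u + 4: the indices add up, but both summands are odd.
criterion-3 : ∀ u → Criterion (3 + 6 * u)
criterion-3 u = unbalanced 3 u (s≤s (s≤s (s≤s (s≤s z≤n)))) (λ ())
  (ord-fibProd 0 (suc (2 * u)) z≤n (index-n u))
  (ord-fibProd 0 (suc (2 * (7 * u + 3))) z≤n (index-7n u))
  (ord-fibProd 0 (suc (2 * u) + suc (2 * (7 * u + 3))) z≤n (index-8n u))
  (prodOrd-strict-odd u (7 * u + 3))
  where
    index-n : ∀ u → 3 + 6 * u ≡ 0 + 3 * suc (2 * u)
    index-n = solve-∀
    index-7n : ∀ u → 7 * (3 + 6 * u) ≡ 0 + 3 * suc (2 * (7 * u + 3))
    index-7n = solve-∀
    index-8n : ∀ u → 8 * (3 + 6 * u) ≡ 0 + 3 * (suc (2 * u) + suc (2 * (7 * u + 3)))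
    index-8n = solve-∀

criterion-4 : ∀ u → Criterion (4 + 6 * u)
criterion-4 u = unbalanced 4 u (s≤s (s≤s (s≤s (s≤s (s≤s z≤n))))) (λ ())
  (ord-fibProd 1 (suc (2 * u)) (s≤s z≤n) (index-n u))
  (ord-fibProd 1 (suc (2 * (7 * u + 4))) (s≤s z≤n) (index-7n u))
  (ord-fibProd 2 (suc (2 * u) + suc (2 * (7 * u + 4))) (s≤s (s≤s z≤n)) (index-8n u))
  (prodOrd-strict-odd u (7 * u + 4))
  where
    index-n : ∀ u → 4 + 6 * u ≡ 1 + 3 * suc (2 * u)
    index-n = solve-∀
    index-7n : ∀ u → 7 * (4 + 6 * u) ≡ 1 + 3 * suc (2 * (7 * u + 4))
    index-7n = solve-∀
    index-8n : ∀ u → 8 * (4 + 6 * u) ≡ 2 + 3 * (suc (2 * u) + suc (2 * (7 * u + 4)))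
    index-8n = solve-∀

criterion-for : ∀ n → 1 ≤ n → Criterion n
criterion-for n 1≤n with residue-view 6 n | 1≤n
... | residue 0 zero _ | ()
... | residue 0 (suc u) _ | _ = criterion-0 (suc u) _
... | residue 1 u _ | _ = criterion-1 u
... | residue 2 u _ | _ = criterion-2 u
... | residue 3 u _ | _ = criterion-3 u
... | residue 4 u _ | _ = criterion-4 u
... | residue 5 u _ | _ = criterion-5 u
... | residue (suc (suc (suc (suc (suc (suc _)))))) _ (s≤s (s≤s (s≤s (s≤s (s≤s (s≤s ())))))) | _

corollary10 : ∀ (n : ℕ) → 1 ≤ n →
    (fibonomial (8 * n) n % 2 ≡ 1 ⇔
      ∃ λ (k : ℕ) → 1 ≤ k × k % 3 ≡ 1 × 7 * n ≡ 1 + 3 * 2 ^ k)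
corollary10 n 1≤n = balanced⇔exceptional ⇔-∘ odd⇔same-ord₂ {fibonomial (8 * n) n} exact (ord₂-* ord-n ord-7n) ord-8n
  where
    open Criterion (criterion-for n 1≤n)
    exact : fibonomial (8 * n) n * (fibProd n * fibProd (7 * n)) ≡ fibProd (8 * n)
    exact = subst (λ m → fibonomial m n * (fibProd n * fibProd (7 * n)) ≡ fibProd m)
                  (one-plus-seven n) (fibonomial-exact n (7 * n))
      where
        one-plus-seven : ∀ n → n + 7 * n ≡ 8 * n
        one-plus-seven = solve-∀
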